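{- Let $G$ be a strongly regular graph with parameters $(76,21,2,7)$, let $u$ be a vertex of $G$ and $w\in G_2(u)$. Let $M=M_w$ be the subgraph of $G$ induced on the $7$ common neighbours of $u$ and $w$ (i.e. on $G_1(u)\cap G_1(w)$). Then each connected component of $M$ has $1$ or $2$ vertices.
   Context: A graph is strongly regular with parameters $(v,k,\lambda,\mu)$ if it has $v$ vertices, every vertex has $k$ neighbours, any two adjacent vertices have exactly $\lambda$ common neighbours, and any two distinct non-adjacent vertices have exactly $\mu$ common neighbours. $G_1(u)$ denotes the set of neighbours of $u$ and $G_2(u)$ the set of vertices at distance $2$ from $u$. -}

module Defs where

open import Data.Nat using (ℕ)
open import Data.Bool using (Bool; false; _∧_)
open import Data.Fin using (Fin)
open import Data.List using (List; length; allFin; filterᵇ)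
open import Data.Product using (_×_)
open import Relation.Binary.PropositionalEquality using (_≡_)
open import Data.Bool using (T)
open import Relation.Nullary using (¬_)

record Graph (n : ℕ) : Set where
  field
    adj       : Fin n → Fin n → Bool
    symmetric : ∀ x y → adj x y ≡ adj y x
    loopless  : ∀ x → adj x x ≡ false
open Graph public

Adj : ∀ {n} → Graph n → Fin n → Fin n → Set
Adj G x y = T (adj G x y)

degree : ∀ {n} → Graph n → Fin n → ℕ
degree {n} G x = length (filterᵇ (adj G x) (allFin n))

commonNbrs : ∀ {n} → Graph n → Fin n → Fin n → ℕ
commonNbrs {n} G x y = length (filterᵇ (λ z → adj G x z ∧ adj G y z) (allFin n))

record IsSRG {n : ℕ} (G : Graph n) (k λ' μ : ℕ) : Set where
  field
    regular    : ∀ x → degree G x ≡ k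
    adjacentλ  : ∀ x y → Adj G x y → commonNbrs G x y ≡ λ'
    nonadjμ    : ∀ x y → ¬ (x ≡ y) → ¬ Adj G x y → commonNbrs G x y ≡ μ

record InG₂ {n : ℕ} (G : Graph n) (u w : Fin n) : Set where
  field
    distinct : ¬ (w ≡ u)
    nonadj   : ¬ Adj G u w
    middle   : Fin n
    adjU     : Adj G u middle
    adjW     : Adj G middle w

InM : ∀ {n} → Graph n → Fin n → Fin n → Fin n → Set
InM G u w x = Adj G u x × Adj G w x

data Reach {n : ℕ} (G : Graph n) (S : Fin n → Set) : Fin n → Fin n → Set where
  here : ∀ {x} → Reach G S x x
  step : ∀ {x y z} → Adj G x y → S y → Reach G S y z → Reach G S x z

module Submission where

-- We show that no vertex of M has two distinct
-- neighbours in M; a graph of maximum degree at most one has components of size ≤ 2.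
--
-- The degree bound is an eigenvalue argument.  Write A for the adjacency matrix and J
-- for the all-ones matrix.  Strong regularity says A² = (k−μ)I + (λ−μ)A + μJ, so for
-- (76,21,2,7) the matrix B = 8I − 4A + J satisfies B² = 36B; hence for every integer
-- vector v,  0 ≤ ⟨Bv,Bv⟩ = 36⟨v,Bv⟩,  i.e.  8⟨v,v⟩ − 4⟨v,Av⟩ + (Σv)² ≥ 0.
-- If c ∈ M had two neighbours p ≠ q in M, test this with v = 4eᵤ + 4e_w + 2χ_M + e_c:
-- the left side equals 89 − 16(E₂ + m_c), where m_c is the number of M-neighbours of c
-- and E₂ = Σ_{j∈M} m_j, while the path p–c–q forces m_c ≥ 2 and E₂ ≥ 4.  Contradiction.

open import Defs
open import Data.Fin using (Fin)
open import Data.Product using (Σ; _×_)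
open import Data.Sum using (_⊎_)
open import Relation.Binary.PropositionalEquality using (_≡_)

open import Function using (_∘_)
open import Data.Nat using (ℕ; zero; suc; z≤n)
open import Data.Bool using (Bool; true; false; T; _∧_; if_then_else_)
open import Data.Unit using (tt)
open import Data.Empty using (⊥; ⊥-elim)
open import Data.Product using (_,_; proj₁; proj₂)
open import Data.Sum using (inj₁; inj₂)
open import Data.Fin using (zero; suc)
open import Data.Fin.Properties using (_≟_; any?)
open import Data.List using (length; tabulate; filterᵇ)
open import Data.Integer using (ℤ; +_; -[1+_]; _+_; _*_; -_; _-_; _≤_; +≤+; nonNegative)
open import Data.Integer.Properties
  using (+-*-semiring; +-identityˡ; +-identityʳ; +-assoc; *-identityˡ; *-identityʳ; *-zeroʳ;
         *-comm; *-assoc; *-distribʳ-+; pos-*; ≤-refl; ≤-reflexive; ≤-trans; +-mono-≤;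
         +-monoʳ-≤; neg-mono-≤; *-monoˡ-≤-nonNeg; *-cancelˡ-≤-pos)
open import Data.Integer.Tactic.RingSolver using (solve-∀)
open import Relation.Nullary using (¬_; Dec; yes; no; does)
open import Relation.Nullary.Decidable using (dec-true; dec-false; T?; _×-dec_; decidable-stable)
open import Relation.Binary.PropositionalEquality
  using (refl; sym; trans; cong; cong₂; subst; _≗_; module ≡-Reasoning)
open import Algebra.Properties.Semiring.Sum +-*-semiring
  using (sum; sum-syntax; sum-cong-≗; sum-replicate-zero; ∑-distrib-+; ∑-comm;
         *-distribˡ-sum; *-distribʳ-sum)

ind : Bool → ℤ
ind true  = + 1
ind false = + 0

ind-nonneg : ∀ b → + 0 ≤ ind b
ind-nonneg true  = +≤+ z≤n
ind-nonneg false = +≤+ z≤n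

ind-∧ : ∀ b c → ind (b ∧ c) ≡ ind b * ind c
ind-∧ true  c = sym (*-identityˡ (ind c))
ind-∧ false c = refl

ind-idem : ∀ b → ind b * ind b ≡ ind b
ind-idem true  = refl
ind-idem false = refl

ind-T : ∀ {b} → T b → ind b ≡ + 1
ind-T {true} _ = refl

ind-¬T : ∀ {b} → ¬ T b → ind b ≡ + 0
ind-¬T {true}  ¬t = ⊥-elim (¬t tt)
ind-¬T {false} _  = refl

nonneg-* : ∀ {x y} → + 0 ≤ x → + 0 ≤ y → + 0 ≤ x * y
nonneg-* {x} x≥0 y≥0 = subst (_≤ x * _) (*-zeroʳ x) (*-monoˡ-≤-nonNeg x {{nonNegative x≥0}} y≥0)

square-nonneg : ∀ x → + 0 ≤ x * x
square-nonneg (+ n)    = subst (+ 0 ≤_) (pos-* n n) (+≤+ z≤n)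
square-nonneg -[1+ n ] = +≤+ z≤n

δ : ∀ {n} → Fin n → Fin n → ℤ
δ s i = ind (does (s ≟ i))

δ-diag : ∀ {n} (s : Fin n) → δ s s ≡ + 1
δ-diag s = cong ind (dec-true (s ≟ s) refl)

δ-off : ∀ {n} {s t : Fin n} → ¬ s ≡ t → δ s t ≡ + 0
δ-off {s = s} {t} s≢t = cong ind (dec-false (s ≟ t) s≢t)

sum-nonneg : ∀ {n} {f : Fin n → ℤ} → (∀ i → + 0 ≤ f i) → + 0 ≤ sum f
sum-nonneg {zero}  f≥0 = ≤-refl
sum-nonneg {suc n} f≥0 = +-mono-≤ (f≥0 zero) (sum-nonneg (f≥0 ∘ suc))

⟨_,_⟩ : ∀ {n} → (Fin n → ℤ) → (Fin n → ℤ) → ℤ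
⟨ x , y ⟩ = sum (λ i → x i * y i)

𝟏 : ∀ {n} → Fin n → ℤ
𝟏 _ = + 1

dot-comm : ∀ {n} (x y : Fin n → ℤ) → ⟨ x , y ⟩ ≡ ⟨ y , x ⟩
dot-comm x y = sum-cong-≗ (λ i → *-comm (x i) (y i))

dot-self-nonneg : ∀ {n} (x : Fin n → ℤ) → + 0 ≤ ⟨ x , x ⟩
dot-self-nonneg x = sum-nonneg (λ i → square-nonneg (x i))

dot-δ : ∀ {n} (s : Fin n) (f : Fin n → ℤ) → ⟨ δ s , f ⟩ ≡ f s
dot-δ {suc n} zero f = begin
  + 1 * f zero + ∑[ i < n ] (+ 0)  ≡⟨ cong₂ _+_ (*-identityˡ (f zero)) (sum-replicate-zero n) ⟩
  f zero + + 0                    ≡⟨ +-identityʳ (f zero) ⟩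
  f zero                          ∎
  where open ≡-Reasoning
dot-δ {suc n} (suc s) f = trans (+-identityˡ _) (dot-δ s (f ∘ suc))

dot-scale : ∀ {n} c (x y : Fin n → ℤ) → ⟨ (λ i → c * x i) , y ⟩ ≡ c * ⟨ x , y ⟩
dot-scale c x y = trans (sum-cong-≗ (λ i → *-assoc c (x i) (y i)))
                        (sym (*-distribˡ-sum c (λ i → x i * y i)))

dot-+ : ∀ {n} (x x′ y : Fin n → ℤ) → ⟨ (λ i → x i + x′ i) , y ⟩ ≡ ⟨ x , y ⟩ + ⟨ x′ , y ⟩
dot-+ x x′ y = trans (sum-cong-≗ (λ i → *-distribʳ-+ (y i) (x i) (x′ i)))
                     (∑-distrib-+ (λ i → x i * y i) (λ i → x′ i * y i))

dot-linear : ∀ {n} (α β γ : ℤ) (f g h y : Fin n → ℤ) →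
  ⟨ (λ i → α * f i + β * g i + γ * h i) , y ⟩ ≡ α * ⟨ f , y ⟩ + β * ⟨ g , y ⟩ + γ * ⟨ h , y ⟩
dot-linear α β γ f g h y = begin
  ⟨ (λ i → α * f i + β * g i + γ * h i) , y ⟩
    ≡⟨ dot-+ (λ i → α * f i + β * g i) (λ i → γ * h i) y ⟩
  ⟨ (λ i → α * f i + β * g i) , y ⟩ + ⟨ (λ i → γ * h i) , y ⟩
    ≡⟨ cong₂ _+_ (dot-+ (λ i → α * f i) (λ i → β * g i) y) (dot-scale γ h y) ⟩
  ⟨ (λ i → α * f i) , y ⟩ + ⟨ (λ i → β * g i) , y ⟩ + γ * ⟨ h , y ⟩
    ≡⟨ cong (_+ γ * ⟨ h , y ⟩) (cong₂ _+_ (dot-scale α f y) (dot-scale β g y)) ⟩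
  α * ⟨ f , y ⟩ + β * ⟨ g , y ⟩ + γ * ⟨ h , y ⟩ ∎
  where open ≡-Reasoning

_without_ : ∀ {n} → (Fin n → ℤ) → Fin n → Fin n → ℤ
(f without s) i = if does (s ≟ i) then + 0 else f i

without-at : ∀ {n} (f : Fin n → ℤ) {s t : Fin n} → ¬ s ≡ t → (f without s) t ≡ f t
without-at f {s} {t} s≢t = cong (λ b → if b then + 0 else f t) (dec-false (s ≟ t) s≢t)

without-nonneg : ∀ {n} {f : Fin n → ℤ} → (∀ i → + 0 ≤ f i) → ∀ s i → + 0 ≤ (f without s) i
without-nonneg f≥0 s i with does (s ≟ i)
... | true  = ≤-refl
... | false = f≥0 i

sum-split : ∀ {n} (s : Fin n) (f : Fin n → ℤ) → sum f ≡ f s + sum (f without s)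
sum-split s f = begin
  sum f
    ≡⟨ sum-cong-≗ (λ i → split (does (s ≟ i)) (f i)) ⟩
  sum (λ i → δ s i * f i + (f without s) i)
    ≡⟨ ∑-distrib-+ (λ i → δ s i * f i) (f without s) ⟩
  ⟨ δ s , f ⟩ + sum (f without s)
    ≡⟨ cong (_+ sum (f without s)) (dot-δ s f) ⟩
  f s + sum (f without s) ∎
  where
  open ≡-Reasoning
  split : ∀ b x → x ≡ ind b * x + (if b then + 0 else x)
  split true  x = sym (trans (+-identityʳ (+ 1 * x)) (*-identityˡ x))
  split false x = sym (+-identityˡ x)

peel : ∀ {n} (s : Fin n) (f : Fin n → ℤ) {x : ℤ} → x ≤ sum (f without s) → f s + x ≤ sum f
peel s f x≤rest = ≤-trans (+-monoʳ-≤ (f s) x≤rest) (≤-reflexive (sym (sum-split s f)))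

point≤sum : ∀ {n} {f : Fin n → ℤ} → (∀ i → + 0 ≤ f i) → ∀ s → f s ≤ sum f
point≤sum {f = f} f≥0 s =
  subst (_≤ sum f) (+-identityʳ (f s)) (peel s f (sum-nonneg (without-nonneg f≥0 s)))

pair≤sum : ∀ {n} {f : Fin n → ℤ} → (∀ i → + 0 ≤ f i) →
  ∀ {s t} → ¬ s ≡ t → f s + f t ≤ sum f
pair≤sum {f = f} f≥0 {s} {t} s≢t =
  peel s f (subst (_≤ _) (without-at f s≢t) (point≤sum (without-nonneg f≥0 s) t))

triple≤sum : ∀ {n} {f : Fin n → ℤ} → (∀ i → + 0 ≤ f i) →
  ∀ {r s t} → ¬ r ≡ s → ¬ r ≡ t → ¬ s ≡ t → f r + f s + f t ≤ sum f
triple≤sum {f = f} f≥0 {r} {s} {t} r≢s r≢t s≢t =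
  subst (_≤ sum f) (sym (+-assoc (f r) (f s) (f t)))
    (peel r f (subst (_≤ _) (cong₂ _+_ (without-at f r≢s) (without-at f r≢t))
                            (pair≤sum (without-nonneg f≥0 r) s≢t)))

_⊙_ : ∀ {n} → (Fin n → Fin n → ℤ) → (Fin n → ℤ) → Fin n → ℤ
(M ⊙ v) i = ⟨ M i , v ⟩

_⊠_ : ∀ {n} → (Fin n → Fin n → ℤ) → (Fin n → Fin n → ℤ) → Fin n → Fin n → ℤ
(M ⊠ N) i k = sum (λ j → M i j * N j k)

Symmetric : ∀ {n} → (Fin n → Fin n → ℤ) → Set
Symmetric M = ∀ i j → M i j ≡ M j i

⊙-adjoint : ∀ {n} {M : Fin n → Fin n → ℤ} → Symmetric M →
  ∀ x y → ⟨ M ⊙ x , y ⟩ ≡ ⟨ x , M ⊙ y ⟩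
⊙-adjoint {M = M} M-sym x y = begin
  sum (λ i → (M ⊙ x) i * y i)
    ≡⟨ sum-cong-≗ (λ i → *-distribʳ-sum (y i) (λ j → M i j * x j)) ⟩
  sum (λ i → sum (λ j → M i j * x j * y i))
    ≡⟨ ∑-comm (λ i j → M i j * x j * y i) ⟩
  sum (λ j → sum (λ i → M i j * x j * y i))
    ≡⟨ sum-cong-≗ (λ j → sum-cong-≗ (λ i → swap i j)) ⟩
  sum (λ j → sum (λ i → x j * (M j i * y i)))
    ≡⟨ sum-cong-≗ (λ j → sym (*-distribˡ-sum (x j) (λ i → M j i * y i))) ⟩
  sum (λ j → x j * (M ⊙ y) j) ∎
  where
  open ≡-Reasoning
  swap : ∀ i j → M i j * x j * y i ≡ x j * (M j i * y i)
  swap i j = trans (cong (λ m → m * x j * y i) (M-sym i j)) (reorder (M j i) (x j) (y i))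
    where
    reorder : ∀ m a b → m * a * b ≡ a * (m * b)
    reorder = solve-∀

⊙-⊙ : ∀ {n} (M N : Fin n → Fin n → ℤ) (v : Fin n → ℤ) → M ⊙ (N ⊙ v) ≗ (M ⊠ N) ⊙ v
⊙-⊙ M N v i = begin
  sum (λ j → M i j * sum (λ k → N j k * v k))
    ≡⟨ sum-cong-≗ (λ j → *-distribˡ-sum (M i j) (λ k → N j k * v k)) ⟩
  sum (λ j → sum (λ k → M i j * (N j k * v k)))
    ≡⟨ ∑-comm (λ j k → M i j * (N j k * v k)) ⟩
  sum (λ k → sum (λ j → M i j * (N j k * v k)))
    ≡⟨ sum-cong-≗ (λ k → sum-cong-≗ (λ j → sym (*-assoc (M i j) (N j k) (v k)))) ⟩
  sum (λ k → sum (λ j → M i j * N j k * v k))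
    ≡⟨ sum-cong-≗ (λ k → sym (*-distribʳ-sum (v k) (λ j → M i j * N j k))) ⟩
  sum (λ k → (M ⊠ N) i k * v k) ∎
  where open ≡-Reasoning

A : ∀ {n} → Graph n → Fin n → Fin n → ℤ
A G i j = ind (adj G i j)

A-sym : ∀ {n} (G : Graph n) → Symmetric (A G)
A-sym G i j = cong ind (symmetric G i j)

A-diag : ∀ {n} (G : Graph n) (i : Fin n) → A G i i ≡ + 0
A-diag G i = cong ind (loopless G i)

Adj-sym : ∀ {n} (G : Graph n) {x y : Fin n} → Adj G x y → Adj G y x
Adj-sym G {x} {y} = subst T (symmetric G x y)

Adj⇒≢ : ∀ {n} (G : Graph n) {x y : Fin n} → Adj G x y → ¬ x ≡ y
Adj⇒≢ G {x} x~x refl = subst T (loopless G x) x~x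

count : ∀ {X : Set} {n} (p : X → Bool) (f : Fin n → X) →
  + length (filterᵇ p (tabulate f)) ≡ sum (λ i → ind (p (f i)))
count {n = zero}  p f = refl
count {n = suc n} p f with p (f zero)
... | true  = cong (_+_ (+ 1)) (count p (f ∘ suc))
... | false = trans (count p (f ∘ suc)) (sym (+-identityˡ _))

row-sum : ∀ {n} (G : Graph n) (x : Fin n) → sum (A G x) ≡ + degree G x
row-sum G x = sym (count (adj G x) (λ i → i))

common-count : ∀ {n} (G : Graph n) (x y : Fin n) →
  sum (λ i → ind (adj G x i ∧ adj G y i)) ≡ + commonNbrs G x y
common-count G x y = sym (count (λ i → adj G x i ∧ adj G y i) (λ i → i))

module StronglyRegular {n} {G : Graph n} {k λ′ μ : ℕ} (srg : IsSRG G k λ′ μ) where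
  open IsSRG srg

  -- A² = (k−μ)I + (λ′−μ)A + μJ, entrywise (the entries of J are 𝟏 l): the diagonal counts
  -- degrees, the off-diagonal entries count common neighbours.
  square : ∀ j l → (A G ⊠ A G) j l ≡ (+ k - + μ) * δ j l + (+ λ′ - + μ) * A G j l + + μ * 𝟏 l
  square j l = trans (sum-cong-≗ (λ i → cong (A G j i *_) (A-sym G i l))) (by-cases (j ≟ l))
    where
    open ≡-Reasoning
    coefficient : ℤ → ℤ → ℤ
    coefficient d a = (+ k - + μ) * d + (+ λ′ - + μ) * a + + μ * + 1
    on-diagonal : ∀ k l m → (k - m) * + 1 + (l - m) * + 0 + m * + 1 ≡ k
    on-diagonal = solve-∀
    on-edge : ∀ k l m → (k - m) * + 0 + (l - m) * + 1 + m * + 1 ≡ l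
    on-edge = solve-∀
    off-edge : ∀ k l m → (k - m) * + 0 + (l - m) * + 0 + m * + 1 ≡ m
    off-edge = solve-∀
    common-sum : ⟨ A G j , A G l ⟩ ≡ + commonNbrs G j l
    common-sum = trans (sum-cong-≗ (λ i → sym (ind-∧ (adj G j i) (adj G l i)))) (common-count G j l)
    by-cases : Dec (j ≡ l) → ⟨ A G j , A G l ⟩ ≡ coefficient (δ j l) (A G j l)
    by-cases (yes refl) = begin
      ⟨ A G j , A G j ⟩         ≡⟨ sum-cong-≗ (λ i → ind-idem (adj G j i)) ⟩
      sum (A G j)               ≡⟨ row-sum G j ⟩
      + degree G j              ≡⟨ cong +_ (regular j) ⟩
      + k                       ≡⟨ on-diagonal (+ k) (+ λ′) (+ μ) ⟨
      coefficient (+ 1) (+ 0)   ≡⟨ cong₂ coefficient (δ-diag j) (A-diag G j) ⟨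
      coefficient (δ j j) (A G j j) ∎
    by-cases (no j≢l) with T? (adj G j l)
    ... | yes j~l = begin
      ⟨ A G j , A G l ⟩         ≡⟨ common-sum ⟩
      + commonNbrs G j l        ≡⟨ cong +_ (adjacentλ j l j~l) ⟩
      + λ′                      ≡⟨ on-edge (+ k) (+ λ′) (+ μ) ⟨
      coefficient (+ 0) (+ 1)   ≡⟨ cong₂ coefficient (δ-off j≢l) (ind-T j~l) ⟨
      coefficient (δ j l) (A G j l) ∎
    ... | no j≁l = begin
      ⟨ A G j , A G l ⟩         ≡⟨ common-sum ⟩
      + commonNbrs G j l        ≡⟨ cong +_ (nonadjμ j l j≢l j≁l) ⟩
      + μ                       ≡⟨ off-edge (+ k) (+ λ′) (+ μ) ⟨
      coefficient (+ 0) (+ 0)   ≡⟨ cong₂ coefficient (δ-off j≢l) (ind-¬T j≁l) ⟨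
      coefficient (δ j l) (A G j l) ∎

  square-apply : ∀ v j →
    (A G ⊙ (A G ⊙ v)) j ≡ (+ k - + μ) * v j + (+ λ′ - + μ) * (A G ⊙ v) j + + μ * ⟨ 𝟏 , v ⟩
  square-apply v j = begin
    (A G ⊙ (A G ⊙ v)) j
      ≡⟨ ⊙-⊙ (A G) (A G) v j ⟩
    ⟨ (A G ⊠ A G) j , v ⟩
      ≡⟨ sum-cong-≗ (λ l → cong (_* v l) (square j l)) ⟩
    ⟨ (λ l → (+ k - + μ) * δ j l + (+ λ′ - + μ) * A G j l + + μ * 𝟏 l) , v ⟩
      ≡⟨ dot-linear (+ k - + μ) (+ λ′ - + μ) (+ μ) (δ j) (A G j) 𝟏 v ⟩
    (+ k - + μ) * ⟨ δ j , v ⟩ + (+ λ′ - + μ) * (A G ⊙ v) j + + μ * ⟨ 𝟏 , v ⟩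
      ≡⟨ cong (λ t → (+ k - + μ) * t + (+ λ′ - + μ) * (A G ⊙ v) j + + μ * ⟨ 𝟏 , v ⟩) (dot-δ j v) ⟩
    (+ k - + μ) * v j + (+ λ′ - + μ) * (A G ⊙ v) j + + μ * ⟨ 𝟏 , v ⟩ ∎
    where open ≡-Reasoning

  sum-⊙ : ∀ v → ⟨ 𝟏 , A G ⊙ v ⟩ ≡ + k * ⟨ 𝟏 , v ⟩
  sum-⊙ v = begin
    ⟨ 𝟏 , A G ⊙ v ⟩                   ≡⟨ ⊙-adjoint (A-sym G) 𝟏 v ⟨
    ⟨ A G ⊙ 𝟏 , v ⟩                   ≡⟨ sum-cong-≗ (λ j → cong (_* v j) (row-degree j)) ⟩
    ⟨ (λ j → + k * 𝟏 j) , v ⟩         ≡⟨ dot-scale (+ k) 𝟏 v ⟩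
    + k * ⟨ 𝟏 , v ⟩                   ∎
    where
    open ≡-Reasoning
    row-degree : ∀ j → (A G ⊙ 𝟏) j ≡ + k * + 1
    row-degree j = begin
      ⟨ A G j , 𝟏 ⟩   ≡⟨ sum-cong-≗ (λ i → *-identityʳ (A G j i)) ⟩
      sum (A G j)     ≡⟨ row-sum G j ⟩
      + degree G j    ≡⟨ cong +_ (regular j) ⟩
      + k             ≡⟨ *-identityʳ (+ k) ⟨
      + k * + 1       ∎

  -- ⟨Av , Av⟩ = ⟨v , A²v⟩ expressed through ⟨v,v⟩, ⟨v,Av⟩ and Σv.
  norm-⊙ : ∀ v → ⟨ A G ⊙ v , A G ⊙ v ⟩ ≡
    (+ k - + μ) * ⟨ v , v ⟩ + (+ λ′ - + μ) * ⟨ v , A G ⊙ v ⟩ + + μ * (⟨ 𝟏 , v ⟩ * ⟨ 𝟏 , v ⟩)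
  norm-⊙ v = begin
    ⟨ A G ⊙ v , A G ⊙ v ⟩
      ≡⟨ ⊙-adjoint (A-sym G) v (A G ⊙ v) ⟩
    ⟨ v , A G ⊙ (A G ⊙ v) ⟩
      ≡⟨ dot-comm v (A G ⊙ (A G ⊙ v)) ⟩
    ⟨ A G ⊙ (A G ⊙ v) , v ⟩
      ≡⟨ sum-cong-≗ (λ j → cong (_* v j) (trans (square-apply v j) (constant-term j))) ⟩
    ⟨ (λ j → (+ k - + μ) * v j + (+ λ′ - + μ) * (A G ⊙ v) j + (+ μ * S) * 𝟏 j) , v ⟩
      ≡⟨ dot-linear (+ k - + μ) (+ λ′ - + μ) (+ μ * S) v (A G ⊙ v) 𝟏 v ⟩
    (+ k - + μ) * ⟨ v , v ⟩ + (+ λ′ - + μ) * ⟨ A G ⊙ v , v ⟩ + + μ * S * S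
      ≡⟨ cong₂ (λ q r → (+ k - + μ) * ⟨ v , v ⟩ + (+ λ′ - + μ) * q + r)
               (dot-comm (A G ⊙ v) v) (*-assoc (+ μ) S S) ⟩
    (+ k - + μ) * ⟨ v , v ⟩ + (+ λ′ - + μ) * ⟨ v , A G ⊙ v ⟩ + + μ * (S * S) ∎
    where
    open ≡-Reasoning
    S : ℤ
    S = ⟨ 𝟏 , v ⟩
    constant-term : ∀ j → (+ k - + μ) * v j + (+ λ′ - + μ) * (A G ⊙ v) j + + μ * S
                        ≡ (+ k - + μ) * v j + (+ λ′ - + μ) * (A G ⊙ v) j + (+ μ * S) * 𝟏 j
    constant-term j = cong (_+_ ((+ k - + μ) * v j + (+ λ′ - + μ) * (A G ⊙ v) j)) (sym (*-identityʳ (+ μ * S)))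

-- With B = 8I − 4A + J and E = Bv we get
-- ⟨E , E⟩ = 36 ⟨v , Bv⟩ from A² = 14I − 5A + 7J, A𝟏 = 21·𝟏 and J𝟏 = 76·𝟏; hence
-- 8⟨v,v⟩ − 4⟨v,Av⟩ + (Σv)² ≥ 0 for every integer vector v.
srg-bound : (G : Graph 76) → IsSRG G 21 2 7 → (v : Fin 76 → ℤ) →
  + 0 ≤ + 8 * ⟨ v , v ⟩ - + 4 * ⟨ v , A G ⊙ v ⟩ + ⟨ 𝟏 , v ⟩ * ⟨ 𝟏 , v ⟩
srg-bound G srg v = *-cancelˡ-≤-pos (+ 0) (+ 8 * P - + 4 * Q + S * S) (+ 36) (subst (+ 0 ≤_) E·E (dot-self-nonneg E))
  where
  open StronglyRegular srg
  open ≡-Reasoning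
  Av : Fin 76 → ℤ
  Av = A G ⊙ v
  P Q S : ℤ
  P = ⟨ v , v ⟩
  Q = ⟨ v , Av ⟩
  S = ⟨ 𝟏 , v ⟩
  E : Fin 76 → ℤ
  E j = + 8 * v j + - (+ 4) * Av j + S * 𝟏 j
  E-against : ∀ y → ⟨ E , y ⟩ ≡ + 8 * ⟨ v , y ⟩ + - (+ 4) * ⟨ Av , y ⟩ + S * ⟨ 𝟏 , y ⟩
  E-against = dot-linear (+ 8) (- (+ 4)) S v Av 𝟏
  v·E : ⟨ E , v ⟩ ≡ + 8 * P + - (+ 4) * Q + S * S
  v·E = trans (E-against v) (cong₂ (λ q s → + 8 * P + - (+ 4) * q + S * s) (dot-comm Av v) refl)
  Av·E : ⟨ E , Av ⟩ ≡ + 8 * Q + - (+ 4) * (+ 14 * P + - (+ 5) * Q + + 7 * (S * S)) + S * (+ 21 * S)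
  Av·E = trans (E-against Av) (cong₂ (λ r t → + 8 * Q + - (+ 4) * r + S * t) (norm-⊙ v) (sum-⊙ v))
  𝟏·E : ⟨ E , 𝟏 ⟩ ≡ + 8 * S + - (+ 4) * (+ 21 * S) + S * + 76
  𝟏·E = trans (E-against 𝟏) (cong₂ (λ s t → + 8 * s + - (+ 4) * t + S * + 76)
                                    (dot-comm v 𝟏) (trans (dot-comm Av 𝟏) (sum-⊙ v)))
  E·E : ⟨ E , E ⟩ ≡ + 36 * (+ 8 * P - + 4 * Q + S * S)
  E·E = begin
    ⟨ E , E ⟩
      ≡⟨ E-against E ⟩
    + 8 * ⟨ v , E ⟩ + - (+ 4) * ⟨ Av , E ⟩ + S * ⟨ 𝟏 , E ⟩
      ≡⟨ cong₂ (λ a b → + 8 * a + - (+ 4) * b + S * ⟨ 𝟏 , E ⟩) (dot-comm v E) (dot-comm Av E) ⟩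
    + 8 * ⟨ E , v ⟩ + - (+ 4) * ⟨ E , Av ⟩ + S * ⟨ 𝟏 , E ⟩
      ≡⟨ cong₂ (λ a c → + 8 * a + - (+ 4) * ⟨ E , Av ⟩ + S * c) v·E (trans (dot-comm 𝟏 E) 𝟏·E) ⟩
    + 8 * (+ 8 * P + - (+ 4) * Q + S * S) + - (+ 4) * ⟨ E , Av ⟩
      + S * (+ 8 * S + - (+ 4) * (+ 21 * S) + S * + 76)
      ≡⟨ cong (λ b → + 8 * (+ 8 * P + - (+ 4) * Q + S * S) + - (+ 4) * b
                      + S * (+ 8 * S + - (+ 4) * (+ 21 * S) + S * + 76)) Av·E ⟩
    + 8 * (+ 8 * P + - (+ 4) * Q + S * S)
      + - (+ 4) * (+ 8 * Q + - (+ 4) * (+ 14 * P + - (+ 5) * Q + + 7 * (S * S)) + S * (+ 21 * S))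
      + S * (+ 8 * S + - (+ 4) * (+ 21 * S) + S * + 76)
      ≡⟨ collect P Q S ⟩
    + 36 * (+ 8 * P - + 4 * Q + S * S) ∎
    where
    collect : ∀ p q s →
      + 8 * (+ 8 * p + - (+ 4) * q + s * s)
        + - (+ 4) * (+ 8 * q + - (+ 4) * (+ 14 * p + - (+ 5) * q + + 7 * (s * s)) + s * (+ 21 * s))
        + s * (+ 8 * s + - (+ 4) * (+ 21 * s) + s * + 76)
      ≡ + 36 * (+ 8 * p - + 4 * q + s * s)
    collect = solve-∀

-- A path p – c – q of length two inside M = G₁(u) ∩ G₁(w) is impossible.  We feed
-- v = 4eᵤ + 4e_w + 2χ + e_c (χ the indicator of M) into srg-bound.
module Cherry (G : Graph 76) (srg : IsSRG G 21 2 7) {u w : Fin 76}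
  (w≢u : ¬ w ≡ u) (u≁w : ¬ Adj G u w) {c p q : Fin 76}
  (c∈M : InM G u w c) (p∈M : InM G u w p) (q∈M : InM G u w q)
  (c~p : Adj G c p) (c~q : Adj G c q) (p≢q : ¬ p ≡ q) where
  open IsSRG srg
  open ≡-Reasoning

  u~c : Adj G u c
  u~c = proj₁ c∈M
  w~c : Adj G w c
  w~c = proj₂ c∈M
  c≢p : ¬ c ≡ p
  c≢p = Adj⇒≢ G c~p
  c≢q : ¬ c ≡ q
  c≢q = Adj⇒≢ G c~q

  χ : Fin 76 → ℤ
  χ i = ind (adj G u i ∧ adj G w i)

  χ-∈M : ∀ {x} → InM G u w x → χ x ≡ + 1
  χ-∈M {x} (u~x , w~x) = trans (ind-∧ (adj G u x) (adj G w x)) (cong₂ _*_ (ind-T u~x) (ind-T w~x))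

  χ-u : χ u ≡ + 0
  χ-u = trans (ind-∧ (adj G u u) (adj G w u)) (cong (_* A G w u) (A-diag G u))

  χ-w : χ w ≡ + 0
  χ-w = trans (ind-∧ (adj G u w) (adj G w w)) (cong (_* A G w w) (ind-¬T u≁w))

  χ⊆N[u] : ∀ j → χ j * A G u j ≡ χ j
  χ⊆N[u] j = absorb (adj G u j) (adj G w j)
    where
    absorb : ∀ a b → ind (a ∧ b) * ind a ≡ ind (a ∧ b)
    absorb true  true  = refl
    absorb true  false = refl
    absorb false b     = refl

  χ⊆N[w] : ∀ j → χ j * A G w j ≡ χ j
  χ⊆N[w] j = absorb (adj G u j) (adj G w j)
    where
    absorb : ∀ a b → ind (a ∧ b) * ind b ≡ ind (a ∧ b)
    absorb true  true  = refl
    absorb true  false = refl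
    absorb false b     = refl

  χ-nonneg : ∀ j → + 0 ≤ χ j
  χ-nonneg j = ind-nonneg (adj G u j ∧ adj G w j)

  |M| : ⟨ χ , 𝟏 ⟩ ≡ + 7
  |M| = begin
    ⟨ χ , 𝟏 ⟩               ≡⟨ sum-cong-≗ (λ i → *-identityʳ (χ i)) ⟩
    sum χ                   ≡⟨ common-count G u w ⟩
    + commonNbrs G u w      ≡⟨ cong +_ (nonadjμ u w (w≢u ∘ sym) u≁w) ⟩
    + 7                     ∎

  ⟨χ,χ⟩ : ⟨ χ , χ ⟩ ≡ + 7
  ⟨χ,χ⟩ = trans (sum-cong-≗ (λ i → trans (ind-idem _) (sym (*-identityʳ (χ i))))) |M|

  m : Fin 76 → ℤ
  m = A G ⊙ χ

  m-term-nonneg : ∀ s j → + 0 ≤ A G s j * χ j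
  m-term-nonneg s j = nonneg-* {A G s j} {χ j} (ind-nonneg (adj G s j)) (χ-nonneg j)

  m-nonneg : ∀ s → + 0 ≤ m s
  m-nonneg s = sum-nonneg (m-term-nonneg s)

  m-u : m u ≡ + 7
  m-u = trans (sum-cong-≗ (λ j → trans (*-comm (A G u j) (χ j)) (trans (χ⊆N[u] j) (sym (*-identityʳ (χ j)))))) |M|

  m-w : m w ≡ + 7
  m-w = trans (sum-cong-≗ (λ j → trans (*-comm (A G w j) (χ j)) (trans (χ⊆N[w] j) (sym (*-identityʳ (χ j)))))) |M|

  -- E₂ = Σ_{s∈M} m s, twice the number of edges of M.
  E₂ : ℤ
  E₂ = ⟨ χ , m ⟩

  v : Fin 76 → ℤ
  v i = + 4 * δ u i + + 4 * δ w i + + 2 * χ i + δ c i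

  probe : ∀ g → ⟨ v , g ⟩ ≡ + 4 * g u + + 4 * g w + + 2 * ⟨ χ , g ⟩ + g c
  probe g = begin
    ⟨ v , g ⟩
      ≡⟨ dot-+ (λ i → + 4 * δ u i + + 4 * δ w i + + 2 * χ i) (δ c) g ⟩
    ⟨ (λ i → + 4 * δ u i + + 4 * δ w i + + 2 * χ i) , g ⟩ + ⟨ δ c , g ⟩
      ≡⟨ cong₂ _+_ (dot-linear (+ 4) (+ 4) (+ 2) (δ u) (δ w) χ g) (dot-δ c g) ⟩
    + 4 * ⟨ δ u , g ⟩ + + 4 * ⟨ δ w , g ⟩ + + 2 * ⟨ χ , g ⟩ + g c
      ≡⟨ cong₂ (λ a b → + 4 * a + + 4 * b + + 2 * ⟨ χ , g ⟩ + g c) (dot-δ u g) (dot-δ w g) ⟩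
    + 4 * g u + + 4 * g w + + 2 * ⟨ χ , g ⟩ + g c ∎

  probe-cong : ∀ {a b x y a′ b′ x′ y′ : ℤ} → a ≡ a′ → b ≡ b′ → x ≡ x′ → y ≡ y′ →
    + 4 * a + + 4 * b + + 2 * x + y ≡ + 4 * a′ + + 4 * b′ + + 2 * x′ + y′
  probe-cong refl refl refl refl = refl

  v-u : v u ≡ + 4
  v-u = probe-cong (δ-diag u) (δ-off w≢u) χ-u (δ-off (Adj⇒≢ G u~c ∘ sym))

  v-w : v w ≡ + 4
  v-w = probe-cong (δ-off (w≢u ∘ sym)) (δ-diag w) χ-w (δ-off (Adj⇒≢ G w~c ∘ sym))

  v-c : v c ≡ + 3
  v-c = probe-cong (δ-off (Adj⇒≢ G u~c)) (δ-off (Adj⇒≢ G w~c)) (χ-∈M c∈M) (δ-diag c)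

  Av-at : ∀ s → (A G ⊙ v) s ≡ + 4 * A G s u + + 4 * A G s w + + 2 * m s + A G s c
  Av-at s = begin
    ⟨ A G s , v ⟩     ≡⟨ dot-comm (A G s) v ⟩
    ⟨ v , A G s ⟩     ≡⟨ probe (A G s) ⟩
    + 4 * A G s u + + 4 * A G s w + + 2 * ⟨ χ , A G s ⟩ + A G s c
      ≡⟨ cong (λ t → + 4 * A G s u + + 4 * A G s w + + 2 * t + A G s c) (dot-comm χ (A G s)) ⟩
    + 4 * A G s u + + 4 * A G s w + + 2 * m s + A G s c ∎

  Av-u : (A G ⊙ v) u ≡ + 15
  Av-u = trans (Av-at u) (probe-cong (A-diag G u) (ind-¬T u≁w) m-u (ind-T u~c))

  Av-w : (A G ⊙ v) w ≡ + 15
  Av-w = trans (Av-at w) (probe-cong (trans (A-sym G w u) (ind-¬T u≁w)) (A-diag G w) m-w (ind-T w~c))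

  Av-c : (A G ⊙ v) c ≡ + 8 + + 2 * m c
  Av-c = trans (Av-at c) (trans (probe-cong c~u c~w refl (A-diag G c)) (+-identityʳ (+ 8 + + 2 * m c)))
    where
    c~u : A G c u ≡ + 1
    c~u = trans (A-sym G c u) (ind-T u~c)
    c~w : A G c w ≡ + 1
    c~w = trans (A-sym G c w) (ind-T w~c)

  S-val : ⟨ 𝟏 , v ⟩ ≡ + 23
  S-val = trans (dot-comm 𝟏 v) (trans (probe 𝟏) (cong (λ t → + 4 * + 1 + + 4 * + 1 + + 2 * t + + 1) |M|))

  χ·v : ⟨ χ , v ⟩ ≡ + 15
  χ·v = trans (dot-comm χ v) (trans (probe χ) (probe-cong χ-u χ-w ⟨χ,χ⟩ (χ-∈M c∈M)))

  P-val : ⟨ v , v ⟩ ≡ + 65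
  P-val = trans (probe v) (probe-cong v-u v-w χ·v v-c)

  χ·Av : ⟨ χ , A G ⊙ v ⟩ ≡ + 56 + + 2 * E₂ + m c
  χ·Av = begin
    ⟨ χ , A G ⊙ v ⟩   ≡⟨ ⊙-adjoint (A-sym G) χ v ⟨
    ⟨ m , v ⟩         ≡⟨ dot-comm m v ⟩
    ⟨ v , m ⟩         ≡⟨ probe m ⟩
    + 4 * m u + + 4 * m w + + 2 * E₂ + m c ≡⟨ probe-cong m-u m-w refl refl ⟩
    + 56 + + 2 * E₂ + m c ∎

  Q-val : ⟨ v , A G ⊙ v ⟩ ≡ + 240 + + 4 * E₂ + + 4 * m c
  Q-val = begin
    ⟨ v , A G ⊙ v ⟩
      ≡⟨ probe (A G ⊙ v) ⟩
    + 4 * (A G ⊙ v) u + + 4 * (A G ⊙ v) w + + 2 * ⟨ χ , A G ⊙ v ⟩ + (A G ⊙ v) c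
      ≡⟨ probe-cong Av-u Av-w χ·Av Av-c ⟩
    + 4 * + 15 + + 4 * + 15 + + 2 * (+ 56 + + 2 * E₂ + m c) + (+ 8 + + 2 * m c)
      ≡⟨ collect E₂ (m c) ⟩
    + 240 + + 4 * E₂ + + 4 * m c ∎
    where
    collect : ∀ e x → + 4 * + 15 + + 4 * + 15 + + 2 * (+ 56 + + 2 * e + x) + (+ 8 + + 2 * x)
                      ≡ + 240 + + 4 * e + + 4 * x
    collect = solve-∀

  edge-bound : + 0 ≤ + 89 - + 16 * (E₂ + m c)
  edge-bound = subst (+ 0 ≤_) evaluate (srg-bound G srg v)
    where
    collect : ∀ e x → + 8 * + 65 - + 4 * (+ 240 + + 4 * e + + 4 * x) + + 23 * + 23 ≡ + 89 - + 16 * (e + x)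
    collect = solve-∀
    evaluate : + 8 * ⟨ v , v ⟩ - + 4 * ⟨ v , A G ⊙ v ⟩ + ⟨ 𝟏 , v ⟩ * ⟨ 𝟏 , v ⟩ ≡ + 89 - + 16 * (E₂ + m c)
    evaluate = begin
      + 8 * ⟨ v , v ⟩ - + 4 * ⟨ v , A G ⊙ v ⟩ + ⟨ 𝟏 , v ⟩ * ⟨ 𝟏 , v ⟩
        ≡⟨ cong₂ (λ P Q → + 8 * P - + 4 * Q + ⟨ 𝟏 , v ⟩ * ⟨ 𝟏 , v ⟩) P-val Q-val ⟩
      + 8 * + 65 - + 4 * (+ 240 + + 4 * E₂ + + 4 * m c) + ⟨ 𝟏 , v ⟩ * ⟨ 𝟏 , v ⟩
        ≡⟨ cong (λ S → + 8 * + 65 - + 4 * (+ 240 + + 4 * E₂ + + 4 * m c) + S * S) S-val ⟩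
      + 8 * + 65 - + 4 * (+ 240 + + 4 * E₂ + + 4 * m c) + + 23 * + 23
        ≡⟨ collect E₂ (m c) ⟩
      + 89 - + 16 * (E₂ + m c) ∎

  m-c : + 2 ≤ m c
  m-c = subst (_≤ m c) two (pair≤sum (m-term-nonneg c) p≢q)
    where
    two : A G c p * χ p + A G c q * χ q ≡ + 2
    two = cong₂ _+_ (cong₂ _*_ (ind-T c~p) (χ-∈M p∈M)) (cong₂ _*_ (ind-T c~q) (χ-∈M q∈M))

  m-neighbour : ∀ {s} → Adj G c s → + 1 ≤ m s
  m-neighbour {s} c~s = subst (_≤ m s) one (point≤sum (m-term-nonneg s) c)
    where
    one : A G s c * χ c ≡ + 1
    one = cong₂ _*_ (trans (A-sym G s c) (ind-T c~s)) (χ-∈M c∈M)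

  E₂-bound : m p + m c + m q ≤ E₂
  E₂-bound = subst (_≤ E₂) on-path
    (triple≤sum (λ j → nonneg-* {χ j} {m j} (χ-nonneg j) (m-nonneg j)) (c≢p ∘ sym) p≢q c≢q)
    where
    weight : ∀ {s} → InM G u w s → χ s * m s ≡ m s
    weight {s} s∈M = trans (cong (_* m s) (χ-∈M s∈M)) (*-identityˡ (m s))
    on-path : χ p * m p + χ c * m c + χ q * m q ≡ m p + m c + m q
    on-path = cong₂ _+_ (cong₂ _+_ (weight p∈M) (weight c∈M)) (weight q∈M)

  -- 0 ≤ 89 − 16(E₂ + m c) ≤ 89 − 96.
  impossible : ⊥
  impossible = 0≰-7 (≤-trans edge-bound (+-monoʳ-≤ (+ 89) (neg-mono-≤ (*-monoˡ-≤-nonNeg (+ 16) six≤))))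
    where
    six≤ : + 6 ≤ E₂ + m c
    six≤ = +-mono-≤ (≤-trans (+-mono-≤ (+-mono-≤ (m-neighbour c~p) m-c) (m-neighbour c~q)) E₂-bound) m-c
    0≰-7 : ¬ (+ 0 ≤ -[1+ 6 ])
    0≰-7 ()

MaxDegreeOne : ∀ {n} → Graph n → (Fin n → Set) → Set
MaxDegreeOne {n} G S = ∀ {c p q : Fin n} → S c → S p → S q → Adj G c p → Adj G c q → p ≡ q

-- In an induced subgraph of maximum degree at most one every connected component has
-- at most two vertices: x together with its unique neighbour y, if there is one.
small-components : ∀ {n} (G : Graph n) (S : Fin n → Set) → (∀ x → Dec (S x)) → MaxDegreeOne G S →
  ∀ x → S x → Σ (Fin n) (λ y → S y × ((z : Fin n) → S z → Reach G S x z → z ≡ x ⊎ z ≡ y))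
small-components G S S? degree≤1 x x∈S with any? (λ j → T? (adj G x j) ×-dec S? j)
... | no isolated = x , x∈S , only-x
  where
  only-x : ∀ z → S z → Reach G S x z → z ≡ x ⊎ z ≡ x
  only-x z _ here              = inj₁ refl
  only-x z _ (step x~t t∈S _) = ⊥-elim (isolated (_ , x~t , t∈S))
... | yes (y , x~y , y∈S) = y , y∈S , λ z _ → stays (inj₁ refl)
  where
  stays : ∀ {s z} → s ≡ x ⊎ s ≡ y → Reach G S s z → z ≡ x ⊎ z ≡ y
  stays s∈xy here = s∈xy
  stays (inj₁ refl) (step x~t t∈S walk) = stays (inj₂ (degree≤1 x∈S t∈S y∈S x~t x~y)) walk
  stays (inj₂ refl) (step y~t t∈S walk) = stays (inj₁ (degree≤1 y∈S t∈S x∈S y~t (Adj-sym G x~y))) walk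

μ-graph-max-degree-one : (G : Graph 76) → IsSRG G 21 2 7 → ∀ {u w} → InG₂ G u w → MaxDegreeOne G (InM G u w)
μ-graph-max-degree-one G srg w∈G₂ {c} {p} {q} c∈M p∈M q∈M c~p c~q =
  decidable-stable (p ≟ q) (Cherry.impossible G srg distinct nonadj c∈M p∈M q∈M c~p c~q)
  where open InG₂ w∈G₂

lemma3 : (G : Graph 76) → IsSRG G 21 2 7 → (u w : Fin 76) → InG₂ G u w →
    (x : Fin 76) → InM G u w x →
      Σ (Fin 76) (λ y → InM G u w y × ((z : Fin 76) → InM G u w z → Reach G (InM G u w) x z → (z ≡ x ⊎ z ≡ y)))
lemma3 G srg u w w∈G₂ =
  small-components G (InM G u w) (λ z → T? (adj G u z) ×-dec T? (adj G w z))
                   (μ-graph-max-degree-one G srg w∈G₂)
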